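{- Let $A,B$ be finite sets with $|A|=|B|=n$, let $s_0s_1\cdots s_{n-1}$ be an ordering of the elements of $A$, and let $f:A\to B$ be a bijection. Let $1\leq i\leq j<k\leq n-1$ be integers. Define the new ordering $s^h$ of $A$ by $$s_0\cdots s_{i-1}\,s_{j+1}\cdots s_k\,s_i\cdots s_j\,s_{k+1}\cdots s_{n-1},$$ and the bijection $f^h:A\to B$ by $f^h(s_{i-1})=f(s_j)$, $f^h(s_k)=f(s_{i-1})$, $f^h(s_j)=f(s_k)$, and $f^h(x)=f(x)$ for all other $x\in A$. Suppose that in $G_f$ the elements $s_{i-1},s_j,s_k$ lie in three distinct components, two of which are directed paths and one of which is a directed cycle. Then in $G_{f^h}$ the elements of these three components form exactly two components (all other components of $G_f$ remain components of $G_{f^h}$), so that $|f^h|=|f|-1$.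
   Context: For a bijection $f:A\to B$, $G_f$ is the directed graph on $A\cup B$ with an edge $x\to y$ whenever $f(x)=y$; its connected components are directed cycles or directed paths, and $|f|$ denotes their number. (The pair $(s^h,f^h)$ is obtained by transposing two adjacent diagonal blocks in the two-row array with top row $s_0\cdots s_{n-1}$ and bottom row $f(s_0)\cdots f(s_{n-1})$; it preserves the map $f(s_t)\mapsto s_{t+1}$, indices mod $n$.) -}

module Defs where

open import Data.Nat using (ℕ; _<_; _∸_)
open import Data.Fin using (Fin)
open import Data.Product using (Σ; ∃; _×_; _,_)
open import Data.Sum using (_⊎_)
open import Data.Bool using (if_then_else_)
open import Relation.Nullary using (¬_)
open import Relation.Nullary.Decidable using (⌊_⌋)
open import Relation.Binary.Definitions using (DecidableEquality)
open import Relation.Binary.PropositionalEquality using (_≡_)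
open import Relation.Binary.Construct.Closure.Equivalence using (EqClosure)
open import Relation.Binary.Construct.Closure.Transitive using (TransClosure)

-- An ordering s₀ … s_{n-1} of A is a map s : ℕ → X (only indices < n matter),
-- and A = { s t | t < n }.  The bijection f : A → B is a map f : X → X
-- (only its values on A matter) injective on A; B = f(A).

InjectiveBelow : {X : Set} → ℕ → (ℕ → X) → Set
InjectiveBelow n s = ∀ t u → t < n → u < n → s t ≡ s u → t ≡ u

InA : {X : Set} → ℕ → (ℕ → X) → X → Set
InA n s x = ∃ λ t → t < n × s t ≡ x

InB : {X : Set} → ℕ → (ℕ → X) → (X → X) → X → Set
InB n s f y = ∃ λ t → t < n × f (s t) ≡ y

Vert : {X : Set} → ℕ → (ℕ → X) → (X → X) → X → Set
Vert n s f x = InA n s x ⊎ InB n s f x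

Edge : {X : Set} → ℕ → (ℕ → X) → (X → X) → X → X → Set
Edge n s f x y = InA n s x × f x ≡ y

Conn : {X : Set} → ℕ → (ℕ → X) → (X → X) → X → X → Set
Conn n s f = EqClosure (Edge n s f)

-- the component of x is a directed cycle: x lies on a directed closed walk
CycleComp : {X : Set} → ℕ → (ℕ → X) → (X → X) → X → Set
CycleComp n s f x = TransClosure (Edge n s f) x x

-- the component of x is a directed path: it contains a vertex with no
-- outgoing edge (the terminal vertex of the path, a vertex of B ∖ A)
PathComp : {X : Set} → ℕ → (ℕ → X) → (X → X) → X → Set
PathComp n s f x = ∃ λ y → Conn n s f x y × Vert n s f y × ¬ InA n s y

TwoPathsOneCycle : {X : Set} → ℕ → (ℕ → X) → (X → X) → X → X → X → Set
TwoPathsOneCycle n s f a b c =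
  (PathComp n s f a × PathComp n s f b × CycleComp n s f c) ⊎
  ((PathComp n s f a × CycleComp n s f b × PathComp n s f c) ⊎
   (CycleComp n s f a × PathComp n s f b × PathComp n s f c))

-- |f| = c : G_f has exactly c connected components, i.e. there is a labelling
-- of the vertices by Fin c, hitting every label, with equal labels exactly
-- for vertices in the same component.
NumComponents : {X : Set} → ℕ → (ℕ → X) → (X → X) → ℕ → Set
NumComponents {X} n s f c =
  Σ (X → Fin c) λ lab →
    (∀ x y → Vert n s f x → Vert n s f y →
       (lab x ≡ lab y → Conn n s f x y) × (Conn n s f x y → lab x ≡ lab y)) ×
    (∀ (l : Fin c) → ∃ λ x → Vert n s f x × lab x ≡ l)

fh : {X : Set} → DecidableEquality X → (ℕ → X) → (X → X) → ℕ → ℕ → ℕ → X → X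
fh _≟_ s f i j k x =
  if ⌊ x ≟ s (i ∸ 1) ⌋ then f (s j)
  else if ⌊ x ≟ s k ⌋ then f (s (i ∸ 1))
  else if ⌊ x ≟ s j ⌋ then f (s k)
  else f x

{-# OPTIONS --safe #-}
-- Since f is injective on A, G_f is the graph of a partial injection: two vertices in one
-- component are comparable under forward reachability, a path component ends in a unique sink
-- outside A, and every vertex of a cycle component reaches each vertex of the cycle.  Call the
-- two path points p, q and the cycle point r (cyclically renaming s_{i-1}, s_j, s_k).  Then
-- f^h = f ∘ ρ for the 3-cycle ρ = (p q r), so in G_{f^h} the point p continues along q's old
-- path, while q runs once around the old cycle and continues along p's old path.  These walks
-- end in the two distinct sinks, so the three components become exactly two; off their union
-- f^h agrees with f, and a labelling of the components is repaired by merging two labels.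
module Submission where

open import Defs
open import Data.Bool using (if_then_else_)
open import Data.Bool.Properties using (if-float)
open import Data.Empty using (⊥-elim)
open import Data.Fin using (Fin; punchIn; punchOut) renaming (_≟_ to _≟ᶠ_)
open import Data.Fin.Properties
  using (¬Fin0; punchOut-injective; punchOut-cong; punchOut-punchIn; punchInᵢ≢i)
open import Data.Nat using (ℕ; zero; suc; _≤_; _<_; _∸_)
open import Data.Nat.Properties using (anyUpTo?; ≤-<-trans; ≤-trans; <-trans; m∸n≤m)
open import Data.Product using (Σ; ∃; _×_; _,_; proj₁; proj₂)
open import Data.Sum using (_⊎_; inj₁; inj₂)
import Data.Sum as Sum
open import Function using (_∘_; id)
open import Relation.Binary.Construct.Closure.Equivalence using (symmetric; return)
open import Relation.Binary.Construct.Closure.ReflexiveTransitive using (ε; _◅_; _◅◅_)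
open import Relation.Binary.Construct.Closure.Symmetric using (SymClosure; fwd; bwd)
import Relation.Binary.Construct.Closure.Symmetric as SC
open import Relation.Binary.Construct.Closure.Transitive using (TransClosure; [_]; _∷_)
open import Relation.Binary.Definitions using (DecidableEquality; Symmetric; Transitive)
open import Relation.Binary.PropositionalEquality
  using (_≡_; _≢_; refl; sym; trans; cong; subst; module ≡-Reasoning)
open import Relation.Nullary using (¬_; Dec; yes; no)
open import Relation.Nullary.Decidable using (⌊_⌋; dec-yes; dec-no; map′; _⊎-dec_)

open ≡-Reasoning

InjectiveOn : {X : Set} → (X → Set) → (X → X) → Set
InjectiveOn A h = ∀ {x y} → A x → A y → h x ≡ h y → x ≡ y

module FunctionalGraph {X : Set} (n : ℕ) (s : ℕ → X) (h : X → X)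
                       (h-inj : InjectiveOn (InA n s) h) where

  _~_ : X → X → Set
  _~_ = Conn n s h

  ~-sym : ∀ {x y} → x ~ y → y ~ x
  ~-sym = symmetric (Edge n s h)

  edge⇒~ : ∀ {x} → InA n s x → x ~ h x
  edge⇒~ a = return (a , refl)

  data Reach : X → X → Set where
    here : ∀ {x} → Reach x x
    step : ∀ {x y} → InA n s x → Reach (h x) y → Reach x y

  Reach-trans : ∀ {x y z} → Reach x y → Reach y z → Reach x z
  Reach-trans here       r′ = r′
  Reach-trans (step a r) r′ = step a (Reach-trans r r′)

  Reach-snoc : ∀ {x y} → Reach x y → InA n s y → Reach x (h y)
  Reach-snoc here       a = step a here
  Reach-snoc (step a′ r) a = step a′ (Reach-snoc r a)

  Reach⇒~ : ∀ {x y} → Reach x y → x ~ y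
  Reach⇒~ here       = ε
  Reach⇒~ (step a r) = fwd (a , refl) ◅ Reach⇒~ r

  Reach-unsnoc : ∀ {x y} → Reach x y →
                 x ≡ y ⊎ ∃ λ y′ → Reach x y′ × InA n s y′ × h y′ ≡ y
  Reach-unsnoc here = inj₁ refl
  Reach-unsnoc (step a r) with Reach-unsnoc r
  ... | inj₁ refl               = inj₂ (_ , here , a , refl)
  ... | inj₂ (y′ , r′ , a′ , e) = inj₂ (y′ , step a r′ , a′ , e)

  Reach-from-same : ∀ {z x y} → Reach z x → Reach z y → Reach x y ⊎ Reach y x
  Reach-from-same here       r           = inj₁ r
  Reach-from-same (step a r) here        = inj₂ (step a r)
  Reach-from-same (step _ r) (step _ r′) = Reach-from-same r r′

  Reach-into-same : ∀ {x y z} → Reach x z → Reach y z → Reach x y ⊎ Reach y x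
  Reach-into-same here       ry = inj₂ ry
  Reach-into-same (step a r) ry with Reach-into-same r ry
  ... | inj₁ hx⇝y = inj₁ (step a hx⇝y)
  ... | inj₂ y⇝hx with Reach-unsnoc y⇝hx
  ...   | inj₁ refl = inj₁ (step a here)
  ...   | inj₂ (y′ , y⇝y′ , a′ , e) with h-inj a′ a e
  ...     | refl = inj₂ y⇝y′

  ~⇒Reach : ∀ {x y} → x ~ y → Reach x y ⊎ Reach y x
  ~⇒Reach ε = inj₁ here
  ~⇒Reach (fwd (a , refl) ◅ rest) with ~⇒Reach rest
  ... | inj₁ r = inj₁ (step a r)
  ... | inj₂ r = Reach-into-same (step a here) r
  ~⇒Reach (bwd (a , refl) ◅ rest) with ~⇒Reach rest
  ... | inj₁ r = Reach-from-same (step a here) r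
  ... | inj₂ r = inj₂ (Reach-snoc r a)

  Reach-from-sink : ∀ {w y} → ¬ InA n s w → Reach w y → w ≡ y
  Reach-from-sink _  here       = refl
  Reach-from-sink na (step a _) = ⊥-elim (na a)

  Reach-sink-tail : ∀ {x w} → InA n s x → ¬ InA n s w → Reach x w → Reach (h x) w
  Reach-sink-tail a na here       = ⊥-elim (na a)
  Reach-sink-tail _ _  (step _ r) = r

  Reach-returns-to-cycle : ∀ {c x y} → Reach (h c) c → Reach x c → Reach x y → Reach y c
  Reach-returns-to-cycle _  x⇝c        here        = x⇝c
  Reach-returns-to-cycle cy here       (step _ r)  = Reach-returns-to-cycle cy cy r
  Reach-returns-to-cycle cy (step _ r) (step _ r′) = Reach-returns-to-cycle cy r r′

  TransClosure⇒Reach : ∀ {x z} → TransClosure (Edge n s h) x z → Reach (h x) z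
  TransClosure⇒Reach [ _ , refl ]        = here
  TransClosure⇒Reach ((_ , refl) ∷ rest) = step (source rest) (TransClosure⇒Reach rest)
    where
    source : ∀ {x z} → TransClosure (Edge n s h) x z → InA n s x
    source [ a , _ ]     = a
    source ((a , _) ∷ _) = a

  ~-sink⇒Reach : ∀ {x w} → InA n s x → x ~ w → ¬ InA n s w → Reach x w
  ~-sink⇒Reach a x~w na with ~⇒Reach x~w
  ... | inj₁ x⇝w = x⇝w
  ... | inj₂ w⇝x with Reach-from-sink na w⇝x
  ...   | refl = ⊥-elim (na a)

  Reach-sink-of-~ : ∀ {x w y} → Reach x w → ¬ InA n s w → x ~ y → Reach y w
  Reach-sink-of-~ x⇝w na x~y with ~⇒Reach x~y
  ... | inj₂ y⇝x = Reach-trans y⇝x x⇝w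
  ... | inj₁ x⇝y with Reach-from-same x⇝y x⇝w
  ...   | inj₁ y⇝w = y⇝w
  ...   | inj₂ w⇝y with Reach-from-sink na w⇝y
  ...     | refl = here

  Reach-cycle-of-~ : ∀ {c y} → Reach (h c) c → c ~ y → Reach y c
  Reach-cycle-of-~ cy c~y with ~⇒Reach c~y
  ... | inj₂ y⇝c = y⇝c
  ... | inj₁ c⇝y = Reach-returns-to-cycle cy here c⇝y

  sink-path-acyclic : ∀ {x w} → InA n s x → Reach x w → ¬ InA n s w → ¬ Reach (h x) x
  sink-path-acyclic a x⇝w na cy with Reach-from-sink na (Reach-returns-to-cycle cy here x⇝w)
  ... | refl = na a

  Reach-sink-unique : ∀ {z v w} → Reach z v → Reach z w → ¬ InA n s v → ¬ InA n s w → v ≡ w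
  Reach-sink-unique z⇝v z⇝w nv nw with Reach-from-same z⇝v z⇝w
  ... | inj₁ v⇝w = Reach-from-sink nv v⇝w
  ... | inj₂ w⇝v = sym (Reach-from-sink nw w⇝v)

  distinct-sinks-apart : ∀ {x y v w} → Reach x v → Reach y w → ¬ InA n s v → ¬ InA n s w →
                         v ≢ w → ¬ x ~ y
  distinct-sinks-apart x⇝v y⇝w nv nw v≢w x~y with ~⇒Reach x~y
  ... | inj₁ x⇝y = v≢w (Reach-sink-unique x⇝v (Reach-trans x⇝y y⇝w) nv nw)
  ... | inj₂ y⇝x = v≢w (Reach-sink-unique (Reach-trans y⇝x x⇝v) y⇝w nv nw)

rotate : {X : Set} → DecidableEquality X → X → X → X → X → X
rotate _≟_ p q r x =
  if ⌊ x ≟ p ⌋ then q else if ⌊ x ≟ r ⌋ then p else if ⌊ x ≟ q ⌋ then r else x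

position : {X : Set} → DecidableEquality X → (p q r x : X) →
           x ≡ p ⊎ (x ≡ q ⊎ (x ≡ r ⊎ (x ≢ p × x ≢ q × x ≢ r)))
position _≟_ p q r x with x ≟ p | x ≟ q | x ≟ r
... | yes x≡p | _       | _       = inj₁ x≡p
... | no _    | yes x≡q | _       = inj₂ (inj₁ x≡q)
... | no _    | no _    | yes x≡r = inj₂ (inj₂ (inj₁ x≡r))
... | no x≢p  | no x≢q  | no x≢r  = inj₂ (inj₂ (inj₂ (x≢p , x≢q , x≢r)))

module Rotation {X : Set} (_≟_ : DecidableEquality X) {p q r : X}
                (p≢q : p ≢ q) (p≢r : p ≢ r) (q≢r : q ≢ r) where

  rotate-p : rotate _≟_ p q r p ≡ q
  rotate-p rewrite proj₂ (dec-yes (p ≟ p) refl) = refl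

  rotate-q : rotate _≟_ p q r q ≡ r
  rotate-q rewrite dec-no (q ≟ p) (p≢q ∘ sym) | dec-no (q ≟ r) q≢r
                 | proj₂ (dec-yes (q ≟ q) refl) = refl

  rotate-r : rotate _≟_ p q r r ≡ p
  rotate-r rewrite dec-no (r ≟ p) (p≢r ∘ sym) | proj₂ (dec-yes (r ≟ r) refl) = refl

  rotate-fixed : ∀ {x} → x ≢ p → x ≢ q → x ≢ r → rotate _≟_ p q r x ≡ x
  rotate-fixed {x} x≢p x≢q x≢r
    rewrite dec-no (x ≟ p) x≢p | dec-no (x ≟ r) x≢r | dec-no (x ≟ q) x≢q = refl

  rotate-cases : (P : X → Set) → P p → P q → P r → ∀ {x} → P x → P (rotate _≟_ p q r x)
  rotate-cases P Pp Pq Pr {x} Px with position _≟_ p q r x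
  ... | inj₁ refl                               = subst P (sym rotate-p) Pq
  ... | inj₂ (inj₁ refl)                        = subst P (sym rotate-q) Pr
  ... | inj₂ (inj₂ (inj₁ refl))                 = subst P (sym rotate-r) Pp
  ... | inj₂ (inj₂ (inj₂ (x≢p , x≢q , x≢r))) = subst P (sym (rotate-fixed x≢p x≢q x≢r)) Px

module _ {X : Set} (_≟_ : DecidableEquality X) {p q r : X}
         (p≢q : p ≢ q) (p≢r : p ≢ r) (q≢r : q ≢ r) where

  open Rotation _≟_ p≢q p≢r q≢r
  private
    module Backwards = Rotation _≟_ (q≢r ∘ sym) (p≢r ∘ sym) (p≢q ∘ sym)
    module Shifted   = Rotation _≟_ q≢r (p≢q ∘ sym) (p≢r ∘ sym)

    ρ⁻¹ : X → X
    ρ⁻¹ = rotate _≟_ r q p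

  rotate-inverse : ∀ x → rotate _≟_ r q p (rotate _≟_ p q r x) ≡ x
  rotate-inverse x with position _≟_ p q r x
  ... | inj₁ refl                               = trans (cong ρ⁻¹ rotate-p) Backwards.rotate-q
  ... | inj₂ (inj₁ refl)                        = trans (cong ρ⁻¹ rotate-q) Backwards.rotate-p
  ... | inj₂ (inj₂ (inj₁ refl))                 = trans (cong ρ⁻¹ rotate-r) Backwards.rotate-r
  ... | inj₂ (inj₂ (inj₂ (x≢p , x≢q , x≢r))) =
    trans (cong ρ⁻¹ (rotate-fixed x≢p x≢q x≢r)) (Backwards.rotate-fixed x≢r x≢q x≢p)

  rotate-shift : ∀ x → rotate _≟_ p q r x ≡ rotate _≟_ q r p x
  rotate-shift x with position _≟_ p q r x
  ... | inj₁ refl                               = trans rotate-p (sym Shifted.rotate-r)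
  ... | inj₂ (inj₁ refl)                        = trans rotate-q (sym Shifted.rotate-p)
  ... | inj₂ (inj₂ (inj₁ refl))                 = trans rotate-r (sym Shifted.rotate-q)
  ... | inj₂ (inj₂ (inj₂ (x≢p , x≢q , x≢r))) =
    trans (rotate-fixed x≢p x≢q x≢r) (sym (Shifted.rotate-fixed x≢q x≢r x≢p))

-- NumComponents n s f is, by definition, HasClasses (Vert n s f) (Conn n s f).
HasClasses : {X : Set} → (X → Set) → (X → X → Set) → ℕ → Set
HasClasses {X} V R c =
  Σ (X → Fin c) λ lab →
    (∀ x y → V x → V y → (lab x ≡ lab y → R x y) × (R x y → lab x ≡ lab y)) ×
    (∀ (l : Fin c) → ∃ λ x → V x × lab x ≡ l)

Union3 : {X : Set} → (X → X → Set) → X → X → X → X → Set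
Union3 R u₁ u₂ u₃ y = R u₁ y ⊎ (R u₂ y ⊎ R u₃ y)

SplitsInTwo : {X : Set} → (X → Set) → (X → X → Set) → (X → Set) → Set
SplitsInTwo V R S =
  ∃ λ a → ∃ λ b → V a × V b × S a × S b × ¬ R a b × (∀ y → S y → R a y ⊎ R b y)

module MergeClasses {X : Set} {V V′ : X → Set} {R R′ : X → X → Set}
  (V? : ∀ x → Dec (V x)) (V′⇒V : ∀ {x} → V′ x → V x) (V⇒V′ : ∀ {x} → V x → V′ x)
  (R′-sym : Symmetric R′) (R′-trans : Transitive R′)
  {u₁ u₂ u₃ : X} (V₁ : V u₁) (V₂ : V u₂) (V₃ : V u₃)
  (u₁≁u₂ : ¬ R u₁ u₂) (u₁≁u₃ : ¬ R u₁ u₃) (u₂≁u₃ : ¬ R u₂ u₃)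
  (separated : ∀ x y → Union3 R u₁ u₂ u₃ x → V y → ¬ Union3 R u₁ u₂ u₃ y → ¬ R′ x y)
  (unchanged : ∀ x y → V x → V y → ¬ Union3 R u₁ u₂ u₃ x → ¬ Union3 R u₁ u₂ u₃ y →
                 (R x y → R′ x y) × (R′ x y → R x y))
  where

  private
    S : X → Set
    S = Union3 R u₁ u₂ u₃

  module Relabel {a b : X} (Va : V a) (Sa : S a) (Vb : V b) (Sb : S b) (a≁b : ¬ R′ a b)
                 (cover : ∀ y → S y → R′ a y ⊎ R′ b y)
                 {c : ℕ} (lab : X → Fin (suc c))
                 (classes : ∀ x y → V x → V y → (lab x ≡ lab y → R x y) × (R x y → lab x ≡ lab y))
                 (onto : ∀ (l : Fin (suc c)) → ∃ λ x → V x × lab x ≡ l) where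

    lab⇒R : ∀ {x y} → V x → V y → lab x ≡ lab y → R x y
    lab⇒R {x} {y} vx vy = proj₁ (classes x y vx vy)

    R⇒lab : ∀ {x y} → V x → V y → R x y → lab x ≡ lab y
    R⇒lab {x} {y} vx vy = proj₂ (classes x y vx vy)

    ℓ₁ ℓ₂ ℓ₃ : Fin (suc c)
    ℓ₁ = lab u₁
    ℓ₂ = lab u₂
    ℓ₃ = lab u₃

    ℓ₁≢ℓ₂ : ℓ₁ ≢ ℓ₂
    ℓ₁≢ℓ₂ = u₁≁u₂ ∘ lab⇒R V₁ V₂
    ℓ₁≢ℓ₃ : ℓ₁ ≢ ℓ₃
    ℓ₁≢ℓ₃ = u₁≁u₃ ∘ lab⇒R V₁ V₃
    ℓ₂≢ℓ₃ : ℓ₂ ≢ ℓ₃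
    ℓ₂≢ℓ₃ = u₂≁u₃ ∘ lab⇒R V₂ V₃

    UnionLabel : Fin (suc c) → Set
    UnionLabel j = j ≡ ℓ₁ ⊎ (j ≡ ℓ₂ ⊎ j ≡ ℓ₃)

    S⇒UnionLabel : ∀ {x} → V x → S x → UnionLabel (lab x)
    S⇒UnionLabel vx = Sum.map (sym ∘ R⇒lab V₁ vx) (Sum.map (sym ∘ R⇒lab V₂ vx) (sym ∘ R⇒lab V₃ vx))

    UnionLabel⇒S : ∀ {x} → V x → UnionLabel (lab x) → S x
    UnionLabel⇒S vx = Sum.map (lab⇒R V₁ vx ∘ sym) (Sum.map (lab⇒R V₂ vx ∘ sym) (lab⇒R V₃ vx ∘ sym))

    S? : ∀ {x} → V x → Dec (S x)
    S? {x} vx = map′ (UnionLabel⇒S vx) (S⇒UnionLabel vx)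
                     (lab x ≟ᶠ ℓ₁ ⊎-dec (lab x ≟ᶠ ℓ₂ ⊎-dec lab x ≟ᶠ ℓ₃))

    -- ℓ₃ goes where ℓ₂ goes; punching ℓ₃ out keeps all other labels apart
    merge : Fin (suc c) → Fin c
    merge j with ℓ₃ ≟ᶠ j
    ... | yes _    = punchOut (ℓ₂≢ℓ₃ ∘ sym)
    ... | no ℓ₃≢j = punchOut ℓ₃≢j

    merge-injective : ∀ {j j′} → j ≢ ℓ₂ → j ≢ ℓ₃ → merge j ≡ merge j′ → j ≡ j′
    merge-injective {j} {j′} j≢ℓ₂ j≢ℓ₃ e with ℓ₃ ≟ᶠ j | ℓ₃ ≟ᶠ j′
    ... | yes ℓ₃≡j | _         = ⊥-elim (j≢ℓ₃ (sym ℓ₃≡j))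
    ... | no ℓ₃≢j  | yes _     = ⊥-elim (j≢ℓ₂ (punchOut-injective ℓ₃≢j (ℓ₂≢ℓ₃ ∘ sym) e))
    ... | no ℓ₃≢j  | no ℓ₃≢j′ = punchOut-injective ℓ₃≢j ℓ₃≢j′ e

    merge-punchIn : ∀ l → merge (punchIn ℓ₃ l) ≡ l
    merge-punchIn l with ℓ₃ ≟ᶠ punchIn ℓ₃ l
    ... | yes e = ⊥-elim (punchInᵢ≢i ℓ₃ l (sym e))
    ... | no _  = trans (punchOut-cong ℓ₃ refl) (punchOut-punchIn ℓ₃)

    merge-outside : ∀ {y j} → V y → ¬ S y → merge (lab y) ≡ merge j → lab y ≡ j
    merge-outside vy ns = merge-injective (ns ∘ UnionLabel⇒S vy ∘ inj₂ ∘ inj₁)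
                                          (ns ∘ UnionLabel⇒S vy ∘ inj₂ ∘ inj₂)

    data Class (x : X) : Set where
      with-a : S x → R′ a x → Class x
      with-b : S x → R′ b x → Class x
      other  : (V x → ¬ S x) → Class x

    classify : ∀ x → Class x
    classify x with V? x
    ... | no ¬vx = other (⊥-elim ∘ ¬vx)
    ... | yes vx with S? vx
    ...   | no ¬sx = other (λ _ → ¬sx)
    ...   | yes sx with cover x sx
    ...     | inj₁ ax = with-a sx ax
    ...     | inj₂ bx = with-b sx bx

    label : ∀ {x} → Class x → Fin c
    label     (with-a _ _) = merge ℓ₁
    label     (with-b _ _) = merge ℓ₂
    label {x} (other _)    = merge (lab x)

    same-label⇒R′ : ∀ {x y} → V x → V y → (cx : Class x) (cy : Class y) →
                    label cx ≡ label cy → R′ x y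
    same-label⇒R′ vx vy (with-a _ ax) (with-a _ ay) _ = R′-trans (R′-sym ax) ay
    same-label⇒R′ vx vy (with-a _ _) (with-b _ _) e =
      ⊥-elim (ℓ₁≢ℓ₂ (merge-injective ℓ₁≢ℓ₂ ℓ₁≢ℓ₃ e))
    same-label⇒R′ vx vy (with-a _ _) (other ns) e =
      ⊥-elim (ns vy (UnionLabel⇒S vy (inj₁ (merge-outside vy (ns vy) (sym e)))))
    same-label⇒R′ vx vy (with-b _ _) (with-a _ _) e =
      ⊥-elim (ℓ₁≢ℓ₂ (merge-injective ℓ₁≢ℓ₂ ℓ₁≢ℓ₃ (sym e)))
    same-label⇒R′ vx vy (with-b _ bx) (with-b _ by) _ = R′-trans (R′-sym bx) by
    same-label⇒R′ vx vy (with-b _ _) (other ns) e =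
      ⊥-elim (ns vy (UnionLabel⇒S vy (inj₂ (inj₁ (merge-outside vy (ns vy) (sym e))))))
    same-label⇒R′ vx vy (other ns) (with-a _ _) e =
      ⊥-elim (ns vx (UnionLabel⇒S vx (inj₁ (merge-outside vx (ns vx) e))))
    same-label⇒R′ vx vy (other ns) (with-b _ _) e =
      ⊥-elim (ns vx (UnionLabel⇒S vx (inj₂ (inj₁ (merge-outside vx (ns vx) e)))))
    same-label⇒R′ vx vy (other nsx) (other nsy) e =
      proj₁ (unchanged _ _ vx vy (nsx vx) (nsy vy)) (lab⇒R vx vy (merge-outside vx (nsx vx) e))

    R′⇒same-label : ∀ {x y} → V x → V y → (cx : Class x) (cy : Class y) →
                    R′ x y → label cx ≡ label cy
    R′⇒same-label vx vy (with-a _ _) (with-a _ _) _ = refl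
    R′⇒same-label vx vy (with-a _ ax) (with-b _ by) xy =
      ⊥-elim (a≁b (R′-trans ax (R′-trans xy (R′-sym by))))
    R′⇒same-label vx vy (with-a sx _) (other ns) xy = ⊥-elim (separated _ _ sx vy (ns vy) xy)
    R′⇒same-label vx vy (with-b _ bx) (with-a _ ay) xy =
      ⊥-elim (a≁b (R′-trans ay (R′-trans (R′-sym xy) (R′-sym bx))))
    R′⇒same-label vx vy (with-b _ _) (with-b _ _) _ = refl
    R′⇒same-label vx vy (with-b sx _) (other ns) xy = ⊥-elim (separated _ _ sx vy (ns vy) xy)
    R′⇒same-label vx vy (other ns) (with-a sy _) xy = ⊥-elim (separated _ _ sy vx (ns vx) (R′-sym xy))
    R′⇒same-label vx vy (other ns) (with-b sy _) xy = ⊥-elim (separated _ _ sy vx (ns vx) (R′-sym xy))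
    R′⇒same-label vx vy (other nsx) (other nsy) xy =
      cong merge (R⇒lab vx vy (proj₂ (unchanged _ _ vx vy (nsx vx) (nsy vy)) xy))

    label-a : (ca : Class a) → label ca ≡ merge ℓ₁
    label-a (with-a _ _)  = refl
    label-a (with-b _ ba) = ⊥-elim (a≁b (R′-sym ba))
    label-a (other ns)    = ⊥-elim (ns Va Sa)

    label-b : (cb : Class b) → label cb ≡ merge ℓ₂
    label-b (with-a _ ab) = ⊥-elim (a≁b ab)
    label-b (with-b _ _)  = refl
    label-b (other ns)    = ⊥-elim (ns Vb Sb)

    label-outside : ∀ {x} → V x → ¬ UnionLabel (lab x) → (cx : Class x) → label cx ≡ merge (lab x)
    label-outside vx nm (with-a sx _) = ⊥-elim (nm (S⇒UnionLabel vx sx))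
    label-outside vx nm (with-b sx _) = ⊥-elim (nm (S⇒UnionLabel vx sx))
    label-outside vx nm (other _)     = refl

    onto′ : ∀ (l : Fin c) → ∃ λ x → V′ x × label (classify x) ≡ l
    onto′ l with punchIn ℓ₃ l ≟ᶠ ℓ₁ | punchIn ℓ₃ l ≟ᶠ ℓ₂
    ... | yes e | _     = a , V⇒V′ Va ,
                          trans (label-a (classify a)) (trans (cong merge (sym e)) (merge-punchIn l))
    ... | no _  | yes e = b , V⇒V′ Vb ,
                          trans (label-b (classify b)) (trans (cong merge (sym e)) (merge-punchIn l))
    ... | no ≢ℓ₁ | no ≢ℓ₂ with onto (punchIn ℓ₃ l)
    ...   | x , vx , e =
            x , V⇒V′ vx , trans (label-outside vx (outside ∘ subst UnionLabel e) (classify x))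
                                (trans (cong merge e) (merge-punchIn l))
      where
      outside : ¬ UnionLabel (punchIn ℓ₃ l)
      outside (inj₁ e)        = ≢ℓ₁ e
      outside (inj₂ (inj₁ e)) = ≢ℓ₂ e
      outside (inj₂ (inj₂ e)) = punchInᵢ≢i ℓ₃ l e

    relabelled : HasClasses V′ R′ c
    relabelled =
      (λ x → label (classify x)) ,
      (λ x y v′x v′y → let vx = V′⇒V v′x; vy = V′⇒V v′y in
         same-label⇒R′ vx vy (classify x) (classify y) ,
         R′⇒same-label vx vy (classify x) (classify y)) ,
      onto′

  merge-classes : SplitsInTwo V R′ S → ∀ c → HasClasses V R c → HasClasses V′ R′ (c ∸ 1)
  merge-classes _ zero (lab , _) = ⊥-elim (¬Fin0 (lab u₁))
  merge-classes (_ , _ , Va , Vb , Sa , Sb , a≁b , cover) (suc c) (lab , classes , onto) =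
    Relabel.relabelled Va Sa Vb Sb a≁b cover lab classes onto

module Reindexing {X : Set} (n : ℕ) (s : ℕ → X) {f g σ τ : X → X}
  (g≗f∘σ : ∀ x → g x ≡ f (σ x))
  (σ-A : ∀ {x} → InA n s x → InA n s (σ x)) (τ-A : ∀ {x} → InA n s x → InA n s (τ x))
  (τ∘σ : ∀ x → τ (σ x) ≡ x) (σ∘τ : ∀ x → σ (τ x) ≡ x) where

  injective : InjectiveOn (InA n s) f → InjectiveOn (InA n s) g
  injective f-inj {x} {y} ax ay gx≡gy = begin
    x           ≡⟨ τ∘σ x ⟨
    τ (σ x)     ≡⟨ cong τ (f-inj (σ-A ax) (σ-A ay) fσx≡fσy) ⟩
    τ (σ y)     ≡⟨ τ∘σ y ⟩
    y           ∎
    where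
    fσx≡fσy : f (σ x) ≡ f (σ y)
    fσx≡fσy = trans (sym (g≗f∘σ x)) (trans gx≡gy (g≗f∘σ y))

  Vert-g⇒f : ∀ {x} → Vert n s g x → Vert n s f x
  Vert-g⇒f (inj₁ a)                = inj₁ a
  Vert-g⇒f (inj₂ (t , t<n , refl)) with σ-A (t , t<n , refl)
  ... | t′ , t′<n , e = inj₂ (t′ , t′<n , trans (cong f e) (sym (g≗f∘σ (s t))))

  Vert-f⇒g : ∀ {x} → Vert n s f x → Vert n s g x
  Vert-f⇒g (inj₁ a)                = inj₁ a
  Vert-f⇒g (inj₂ (t , t<n , refl)) with τ-A (t , t<n , refl)
  ... | t′ , t′<n , e =
    inj₂ (t′ , t′<n , trans (g≗f∘σ (s t′)) (cong f (trans (cong σ e) (σ∘τ (s t)))))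

module Rerouting {X : Set} (_≟_ : DecidableEquality X) (n : ℕ) (s : ℕ → X) (f g : X → X)
  (f-inj : InjectiveOn (InA n s) f)
  {p q r : X} (Ap : InA n s p) (Aq : InA n s q) (Ar : InA n s r)
  (p≁q : ¬ Conn n s f p q) (p≁r : ¬ Conn n s f p r) (q≁r : ¬ Conn n s f q r)
  (g≗f∘rotate : ∀ x → g x ≡ f (rotate _≟_ p q r x))
  (S : X → Set) (S-intro : ∀ {y} → Union3 (Conn n s f) p q r y → S y)
  (S-elim : ∀ {y} → S y → Union3 (Conn n s f) p q r y) where

  module F = FunctionalGraph n s f f-inj

  apart : ∀ {u v z} → ¬ Conn n s f u v → Conn n s f u z → z ≢ v
  apart u≁v u~z refl = u≁v u~z

  p≢q : p ≢ q
  p≢q = apart p≁q ε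
  p≢r : p ≢ r
  p≢r = apart p≁r ε
  q≢r : q ≢ r
  q≢r = apart q≁r ε

  open Rotation _≟_ p≢q p≢r q≢r
  private
    module Backwards = Rotation _≟_ (q≢r ∘ sym) (p≢r ∘ sym) (p≢q ∘ sym)
    module Reindexed = Reindexing n s {f = f} g≗f∘rotate
      (rotate-cases (InA n s) Ap Aq Ar) (Backwards.rotate-cases (InA n s) Ar Aq Ap)
      (rotate-inverse _≟_ p≢q p≢r q≢r) (rotate-inverse _≟_ (q≢r ∘ sym) (p≢r ∘ sym) (p≢q ∘ sym))

  open Reindexed public using (Vert-g⇒f; Vert-f⇒g)

  module G = FunctionalGraph n s g (Reindexed.injective f-inj)

  gp : g p ≡ f q
  gp = trans (g≗f∘rotate p) (cong f rotate-p)
  gq : g q ≡ f r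
  gq = trans (g≗f∘rotate q) (cong f rotate-q)
  gr : g r ≡ f p
  gr = trans (g≗f∘rotate r) (cong f rotate-r)

  g-fixed : ∀ {x} → x ≢ p → x ≢ q → x ≢ r → g x ≡ f x
  g-fixed x≢p x≢q x≢r = trans (g≗f∘rotate _) (cong f (rotate-fixed x≢p x≢q x≢r))

  Reach-f⇒g : ∀ {y t} → F.Reach y t → (∀ {z} → F.Reach y z → z ≢ t → g z ≡ f z) → G.Reach y t
  Reach-f⇒g F.here _ = G.here
  Reach-f⇒g {y} {t} (F.step a y⇝t) fixed with y ≟ t
  ... | yes refl = G.here
  ... | no y≢t   = G.step a (subst (λ w → G.Reach w t) (sym (fixed F.here y≢t))
                                    (Reach-f⇒g y⇝t (fixed ∘ F.step a)))

  jump : ∀ {u v t} → InA n s u → g u ≡ f v → F.Reach (f v) t →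
         (∀ {z} → F.Reach (f v) z → z ≢ t → g z ≡ f z) → G.Reach u t
  jump {t = t} a gu≡fv fv⇝t fixed =
    G.step a (subst (λ w → G.Reach w t) (sym gu≡fv) (Reach-f⇒g fv⇝t fixed))

  module Rejoin (path-p : PathComp n s f p) (path-q : PathComp n s f q)
                (cycle-r : CycleComp n s f r) where

    wp wq : X
    wp = proj₁ path-p
    wq = proj₁ path-q

    sink-p : ¬ InA n s wp
    sink-p = proj₂ (proj₂ (proj₂ path-p))
    sink-q : ¬ InA n s wq
    sink-q = proj₂ (proj₂ (proj₂ path-q))

    p⇝wp : F.Reach p wp
    p⇝wp = F.~-sink⇒Reach Ap (proj₁ (proj₂ path-p)) sink-p
    q⇝wq : F.Reach q wq
    q⇝wq = F.~-sink⇒Reach Aq (proj₁ (proj₂ path-q)) sink-q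

    r-cycle : F.Reach (f r) r
    r-cycle = F.TransClosure⇒Reach cycle-r

    fixed-on-cycle : ∀ {z} → F.Reach (f r) z → z ≢ r → g z ≡ f z
    fixed-on-cycle fr⇝z = g-fixed (apart (p≁r ∘ F.~-sym) r~z) (apart (q≁r ∘ F.~-sym) r~z)
      where r~z = F.Reach⇒~ (F.step Ar fr⇝z)

    fixed-after-p : ∀ {z} → F.Reach (f p) z → z ≢ wp → g z ≡ f z
    fixed-after-p fp⇝z _ =
      g-fixed (λ { refl → F.sink-path-acyclic Ap p⇝wp sink-p fp⇝z }) (apart p≁q p~z) (apart p≁r p~z)
      where p~z = F.Reach⇒~ (F.step Ap fp⇝z)

    fixed-after-q : ∀ {z} → F.Reach (f q) z → z ≢ wq → g z ≡ f z
    fixed-after-q fq⇝z _ =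
      g-fixed (apart (p≁q ∘ F.~-sym) q~z) (λ { refl → F.sink-path-acyclic Aq q⇝wq sink-q fq⇝z })
              (apart q≁r q~z)
      where q~z = F.Reach⇒~ (F.step Aq fq⇝z)

    q⇝r : G.Reach q r
    q⇝r = jump Aq gq r-cycle fixed-on-cycle

    q⇝wp : G.Reach q wp
    q⇝wp = G.Reach-trans q⇝r (jump Ar gr (F.Reach-sink-tail Ap sink-p p⇝wp) fixed-after-p)

    p⇝wq : G.Reach p wq
    p⇝wq = jump Ap gp (F.Reach-sink-tail Aq sink-q q⇝wq) fixed-after-q

    p≁q-after : ¬ Conn n s g p q
    p≁q-after = G.distinct-sinks-apart p⇝wq q⇝wp sink-q sink-p wq≢wp
      where
      wq≢wp : wq ≢ wp
      wq≢wp refl = p≁q (F.Reach⇒~ p⇝wp ◅◅ F.~-sym (F.Reach⇒~ q⇝wq))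

    OnPQ : X → Set
    OnPQ y = Conn n s g p y ⊎ Conn n s g q y

    OnPQ-backwards : ∀ {y t} → F.Reach y t → OnPQ t → OnPQ y
    OnPQ-backwards F.here on-t = on-t
    OnPQ-backwards {y} (F.step a y⇝t) on-t with position _≟_ p q r y
    ... | inj₁ refl                               = inj₁ ε
    ... | inj₂ (inj₁ refl)                        = inj₂ ε
    ... | inj₂ (inj₂ (inj₁ refl))                 = inj₂ (G.Reach⇒~ q⇝r)
    ... | inj₂ (inj₂ (inj₂ (y≢p , y≢q , y≢r))) =
      Sum.map extend extend (subst OnPQ (sym (g-fixed y≢p y≢q y≢r)) (OnPQ-backwards y⇝t on-t))
      where
      extend : ∀ {u} → Conn n s g u (g y) → Conn n s g u y
      extend u~gy = u~gy ◅◅ G.~-sym (G.edge⇒~ a)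

    splits : SplitsInTwo (Vert n s f) (Conn n s g) S
    splits = p , q , inj₁ Ap , inj₁ Aq , S-intro (inj₁ ε) , S-intro (inj₂ (inj₁ ε)) , p≁q-after ,
             λ y → cover ∘ S-elim
      where
      cover : ∀ {y} → Union3 (Conn n s f) p q r y → OnPQ y
      cover (inj₁ p~y) =
        OnPQ-backwards (F.Reach-sink-of-~ p⇝wp sink-p p~y) (inj₂ (G.Reach⇒~ q⇝wp))
      cover (inj₂ (inj₁ q~y)) =
        OnPQ-backwards (F.Reach-sink-of-~ q⇝wq sink-q q~y) (inj₁ (G.Reach⇒~ p⇝wq))
      cover (inj₂ (inj₂ r~y)) =
        OnPQ-backwards (F.Reach-cycle-of-~ r-cycle r~y) (inj₂ (G.Reach⇒~ q⇝r))

  fixed-outside : ∀ (T : X → X) → S (T p) → S (T q) → S (T r) → ∀ {u} → ¬ S (T u) → g u ≡ f u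
  fixed-outside T STp STq STr {u} ¬STu with position _≟_ p q r u
  ... | inj₁ refl                               = ⊥-elim (¬STu STp)
  ... | inj₂ (inj₁ refl)                        = ⊥-elim (¬STu STq)
  ... | inj₂ (inj₂ (inj₁ refl))                 = ⊥-elim (¬STu STr)
  ... | inj₂ (inj₂ (inj₂ (u≢p , u≢q , u≢r))) = g-fixed u≢p u≢q u≢r

  S-p : S p
  S-p = S-intro (inj₁ ε)
  S-q : S q
  S-q = S-intro (inj₂ (inj₁ ε))
  S-r : S r
  S-r = S-intro (inj₂ (inj₂ ε))

  S-f : ∀ {u} → InA n s u → S u → S (f u)
  S-f a Su = S-intro (Sum.map extend (Sum.map extend extend) (S-elim Su))
    where
    extend : ∀ {v} → Conn n s f v _ → Conn n s f v (f _)
    extend v~u = v~u ◅◅ F.edge⇒~ a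

  fixed-off-S : ∀ {u} → ¬ S u → g u ≡ f u
  fixed-off-S = fixed-outside id S-p S-q S-r

  fixed-into-off-S-f : ∀ {u} → ¬ S (f u) → g u ≡ f u
  fixed-into-off-S-f = fixed-outside f (S-f Ap S-p) (S-f Aq S-q) (S-f Ar S-r)

  fixed-into-off-S-g : ∀ {u} → ¬ S (g u) → g u ≡ f u
  fixed-into-off-S-g = fixed-outside g (subst S (sym gp) (S-f Aq S-q)) (subst S (sym gq) (S-f Ar S-r))
                                       (subst S (sym gr) (S-f Ap S-p))

  S-backwards : ∀ {x z} → SymClosure (Edge n s f) x z → S z → S x
  S-backwards x—z Sz = S-intro (Sum.map extend (Sum.map extend extend) (S-elim Sz))
    where
    extend : ∀ {v} → Conn n s f v _ → Conn n s f v _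
    extend v~z = v~z ◅◅ (SC.symmetric (Edge n s f) x—z ◅ ε)

  edge-f⇒g : ∀ {x z} → ¬ S x → SymClosure (Edge n s f) x z → SymClosure (Edge n s g) x z
  edge-f⇒g ¬Sx (fwd (a , fx≡z)) = fwd (a , trans (fixed-off-S ¬Sx) fx≡z)
  edge-f⇒g ¬Sx (bwd (a , fz≡x)) =
    bwd (a , trans (fixed-into-off-S-f (subst (¬_ ∘ S) (sym fz≡x) ¬Sx)) fz≡x)

  edge-g⇒f : ∀ {x z} → ¬ S x → SymClosure (Edge n s g) x z → SymClosure (Edge n s f) x z
  edge-g⇒f ¬Sx (fwd (a , gx≡z)) = fwd (a , trans (sym (fixed-off-S ¬Sx)) gx≡z)
  edge-g⇒f ¬Sx (bwd (a , gz≡x)) =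
    bwd (a , trans (sym (fixed-into-off-S-g (subst (¬_ ∘ S) (sym gz≡x) ¬Sx))) gz≡x)

  Conn-f⇒g : ∀ {x y} → ¬ S x → Conn n s f x y → Conn n s g x y × ¬ S y
  Conn-f⇒g ¬Sx ε = ε , ¬Sx
  Conn-f⇒g ¬Sx (x—z ◅ z~y) with Conn-f⇒g (¬Sx ∘ S-backwards x—z) z~y
  ... | z~′y , ¬Sy = edge-f⇒g ¬Sx x—z ◅ z~′y , ¬Sy

  Conn-g⇒f : ∀ {x y} → ¬ S x → Conn n s g x y → Conn n s f x y × ¬ S y
  Conn-g⇒f ¬Sx ε = ε , ¬Sx
  Conn-g⇒f ¬Sx (x—z ◅ z~y) with edge-g⇒f ¬Sx x—z
  ... | x—′z with Conn-g⇒f (¬Sx ∘ S-backwards x—′z) z~y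
  ...   | z~′y , ¬Sy = x—′z ◅ z~′y , ¬Sy

  separated : ∀ x y → S x → Vert n s f y → ¬ S y → ¬ Conn n s g x y
  separated x y Sx _ ¬Sy x~y = proj₂ (Conn-g⇒f ¬Sy (G.~-sym x~y)) Sx

  unchanged : ∀ x y → Vert n s f x → Vert n s f y → ¬ S x → ¬ S y →
              (Conn n s f x y → Conn n s g x y) × (Conn n s g x y → Conn n s f x y)
  unchanged x y _ _ ¬Sx _ = proj₁ ∘ Conn-f⇒g ¬Sx , proj₁ ∘ Conn-g⇒f ¬Sx

Vert? : {X : Set} → DecidableEquality X → ∀ n s f (x : X) → Dec (Vert n s f x)
Vert? _≟_ n s f x = anyUpTo? (λ t → s t ≟ x) n ⊎-dec anyUpTo? (λ t → f (s t) ≟ x) n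

fh≗f∘rotate : {X : Set} (_≟_ : DecidableEquality X) (s : ℕ → X) (f : X → X) (i j k : ℕ) →
              ∀ x → fh _≟_ s f i j k x ≡ f (rotate _≟_ (s (i ∸ 1)) (s j) (s k) x)
fh≗f∘rotate _≟_ s f i j k x = sym (begin
  f (if b₁ then s j else if b₂ then s (i ∸ 1) else if b₃ then s k else x)
    ≡⟨ if-float f b₁ ⟩
  (if b₁ then f (s j) else f (if b₂ then s (i ∸ 1) else if b₃ then s k else x))
    ≡⟨ cong (if b₁ then f (s j) else_) (if-float f b₂) ⟩
  (if b₁ then f (s j) else if b₂ then f (s (i ∸ 1)) else f (if b₃ then s k else x))
    ≡⟨ cong (λ e → if b₁ then f (s j) else if b₂ then f (s (i ∸ 1)) else e) (if-float f b₃) ⟩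
  fh _≟_ s f i j k x ∎)
  where
  b₁ = ⌊ x ≟ s (i ∸ 1) ⌋
  b₂ = ⌊ x ≟ s k ⌋
  b₃ = ⌊ x ≟ s j ⌋

⊎-rotate : {A B C : Set} → A ⊎ (B ⊎ C) → B ⊎ (C ⊎ A)
⊎-rotate (inj₁ a)        = inj₂ (inj₂ a)
⊎-rotate (inj₂ (inj₁ b)) = inj₁ b
⊎-rotate (inj₂ (inj₂ c)) = inj₂ (inj₁ c)

module RotatedTriple {X : Set} (_≟_ : DecidableEquality X) (n : ℕ) (s : ℕ → X) (f g : X → X)
  (f-inj : InjectiveOn (InA n s) f)
  {a b c : X} (Aa : InA n s a) (Ab : InA n s b) (Ac : InA n s c)
  (a≁b : ¬ Conn n s f a b) (a≁c : ¬ Conn n s f a c) (b≁c : ¬ Conn n s f b c)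
  (g≗f∘rotate : ∀ x → g x ≡ f (rotate _≟_ a b c x)) where

  private
    S : X → Set
    S = Union3 (Conn n s f) a b c

    module R = Rerouting _≟_ n s f g f-inj Aa Ab Ac a≁b a≁c b≁c g≗f∘rotate S id id

  open R public using (Vert-g⇒f; Vert-f⇒g; separated; unchanged)

  private
    ≁-sym : ∀ {x y} → ¬ Conn n s f x y → ¬ Conn n s f y x
    ≁-sym x≁y = x≁y ∘ symmetric (Edge n s f)

    g≗f∘rotate-bca : ∀ x → g x ≡ f (rotate _≟_ b c a x)
    g≗f∘rotate-bca x = trans (g≗f∘rotate x) (cong f (rotate-shift _≟_ R.p≢q R.p≢r R.q≢r x))

    g≗f∘rotate-cab : ∀ x → g x ≡ f (rotate _≟_ c a b x)
    g≗f∘rotate-cab x =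
      trans (g≗f∘rotate-bca x) (cong f (rotate-shift _≟_ R.q≢r (R.p≢q ∘ sym) (R.p≢r ∘ sym) x))

  splits : TwoPathsOneCycle n s f a b c → SplitsInTwo (Vert n s f) (Conn n s g) S
  splits (inj₁ (path-a , path-b , cycle-c)) = R.Rejoin.splits path-a path-b cycle-c
  splits (inj₂ (inj₁ (path-a , cycle-b , path-c))) =
    Rerouting.Rejoin.splits _≟_ n s f g f-inj Ac Aa Ab (≁-sym a≁c) (≁-sym b≁c) a≁b g≗f∘rotate-cab
      S ⊎-rotate (⊎-rotate ∘ ⊎-rotate) path-c path-a cycle-b
  splits (inj₂ (inj₂ (cycle-a , path-b , path-c))) =
    Rerouting.Rejoin.splits _≟_ n s f g f-inj Ab Ac Aa b≁c (≁-sym a≁b) (≁-sym a≁c) g≗f∘rotate-bca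
      S (⊎-rotate ∘ ⊎-rotate) ⊎-rotate path-b path-c cycle-a

lemma3 : {X : Set} (_≟_ : DecidableEquality X) (n : ℕ) (s : ℕ → X) (f : X → X)
    → InjectiveBelow n s
    → InjectiveBelow n (λ t → f (s t))
    → (i j k : ℕ) → 1 ≤ i → i ≤ j → j < k → k < n
    → ¬ Conn n s f (s (i ∸ 1)) (s j)
    → ¬ Conn n s f (s (i ∸ 1)) (s k)
    → ¬ Conn n s f (s j) (s k)
    → TwoPathsOneCycle n s f (s (i ∸ 1)) (s j) (s k)
    → let g = fh _≟_ s f i j k
          S = λ y → Conn n s f (s (i ∸ 1)) y ⊎ (Conn n s f (s j) y ⊎ Conn n s f (s k) y)
      in
      -- the elements of the three components form exactly two components of G_{f^h}
      (∃ λ a → ∃ λ b → S a × S b × ¬ Conn n s g a b ×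
         (∀ y → S y → Conn n s g a y ⊎ Conn n s g b y))
      × (∀ x y → S x → Vert n s f y → ¬ S y → ¬ Conn n s g x y)
      -- all other components of G_f remain components of G_{f^h}
      × (∀ x y → Vert n s f x → Vert n s f y → ¬ S x → ¬ S y →
           (Conn n s f x y → Conn n s g x y) × (Conn n s g x y → Conn n s f x y))
      -- |f^h| = |f| - 1
      × (∀ c → NumComponents n s f c → NumComponents n s g (c ∸ 1))
lemma3 _≟_ n s f _ fs-inj i j k 1≤i i≤j j<k k<n a≁b a≁c b≁c shape =
  forget-vertices (T.splits shape) , T.separated , T.unchanged , M.merge-classes (T.splits shape)
  where
  a = s (i ∸ 1)
  b = s j
  c = s k
  g = fh _≟_ s f i j k
  S = Union3 (Conn n s f) a b c

  Aa : InA n s a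
  Aa = i ∸ 1 , ≤-<-trans (≤-trans (m∸n≤m i 1) i≤j) (<-trans j<k k<n) , refl
  Ab : InA n s b
  Ab = j , <-trans j<k k<n , refl
  Ac : InA n s c
  Ac = k , k<n , refl

  f-inj : InjectiveOn (InA n s) f
  f-inj (t , t<n , refl) (u , u<n , refl) e = cong s (fs-inj t u t<n u<n e)

  module T = RotatedTriple _≟_ n s f g f-inj Aa Ab Ac a≁b a≁c b≁c (fh≗f∘rotate _≟_ s f i j k)

  forget-vertices : SplitsInTwo (Vert n s f) (Conn n s g) S →
                    ∃ λ a → ∃ λ b → S a × S b × ¬ Conn n s g a b ×
                      (∀ y → S y → Conn n s g a y ⊎ Conn n s g b y)
  forget-vertices (a , b , _ , _ , Sa , Sb , a≁b , cover) = a , b , Sa , Sb , a≁b , cover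

  module M = MergeClasses (Vert? _≟_ n s f) T.Vert-g⇒f T.Vert-f⇒g
               (symmetric (Edge n s g)) _◅◅_ (inj₁ Aa) (inj₁ Ab) (inj₁ Ac) a≁b a≁c b≁c
               T.separated T.unchanged
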